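{- Every exponential polynomial functor $\mathsf{T}$ admits a strongly adequate uniform construction.
   Context: Exponential polynomial functors are the set functors generated by the grammar $\mathsf{T}::=\mathsf{C}\mid\mathsf{Id}\mid\mathsf{T}\times\mathsf{T}\mid\coprod_{i\in I}\mathsf{T}_i\mid\mathsf{T}(-)^{C}$, where $\mathsf{C}$ is the constant functor on an arbitrary set $C$, $\mathsf{Id}$ the identity functor, $\times$ and $\coprod$ are pointwise product and (arbitrary) coproduct, and $\mathsf{T}(-)^C$ sends $X$ to $(\mathsf{T}X)^C$. A uniform construction for $\mathsf{T}$ assigns to each pair $(X,\alpha)$ with $\alpha\in\mathsf{T}X$ a set $X_*$, an element $\alpha_*\in\mathsf{T}X_*$, and a map $h_\alpha:X_*\to X$ with $\mathsf{T}h_\alpha(\alpha_*)=\alpha$. It is strongly adequate if for every map $f:X\to Y$ and all $\alpha\in\mathsf{T}X$, $\beta\in\mathsf{T}Y$ with $\mathsf{T}f(\alpha)=\beta$ there is a bijection $g:X_*\to Y_*$ with $\mathsf{T}g(\alpha_*)=\beta_*$ and $f\circ h_\alpha=h_\beta\circ g$. -}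

module Defs where

open import Data.Product using (Σ; _×_; _,_)
open import Relation.Binary.PropositionalEquality using (_≡_; subst)
open import Function.Bundles using (_⤖_; Bijection)

data EPF : Set₁ where
  K    : (C : Set) → EPF
  Id   : EPF
  _⊗_  : EPF → EPF → EPF
  ∐    : (I : Set) → (I → EPF) → EPF
  _^_  : EPF → (C : Set) → EPF

⟦_⟧ : EPF → Set → Set
⟦ K C ⟧ X = C
⟦ Id ⟧ X = X
⟦ S ⊗ T ⟧ X = ⟦ S ⟧ X × ⟦ T ⟧ X
⟦ ∐ I T ⟧ X = Σ I (λ i → ⟦ T i ⟧ X)
⟦ T ^ C ⟧ X = C → ⟦ T ⟧ X

fmap : (T : EPF) {X Y : Set} → (X → Y) → ⟦ T ⟧ X → ⟦ T ⟧ Y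
fmap (K C) f c = c
fmap Id f x = f x
fmap (S ⊗ T) f (a , b) = fmap S f a , fmap T f b
fmap (∐ I T) f (i , a) = i , fmap (T i) f a
fmap (T ^ C) f g = λ c → fmap T f (g c)

-- Equality of elements of T X (extensional on the exponent components,
-- as equality of functions between sets is in set theory).
Eq : (T : EPF) {X : Set} → ⟦ T ⟧ X → ⟦ T ⟧ X → Set
Eq (K C) a b = a ≡ b
Eq Id a b = a ≡ b
Eq (S ⊗ T) (a₁ , a₂) (b₁ , b₂) = Eq S a₁ b₁ × Eq T a₂ b₂
Eq (∐ I T) {X} (i , a) (j , b) =
  Σ (i ≡ j) (λ p → Eq (T j) (subst (λ k → ⟦ T k ⟧ X) p a) b)
Eq (T ^ C) f g = ∀ c → Eq T (f c) (g c)

record UniformConstruction (T : EPF) : Set₁ where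
  field
    Star : (X : Set) → ⟦ T ⟧ X → Set
    star : (X : Set) (α : ⟦ T ⟧ X) → ⟦ T ⟧ (Star X α)
    h    : (X : Set) (α : ⟦ T ⟧ X) → Star X α → X
    law  : (X : Set) (α : ⟦ T ⟧ X) → Eq T (fmap T (h X α) (star X α)) α

StronglyAdequate : (T : EPF) → UniformConstruction T → Set₁
StronglyAdequate T U =
  (X Y : Set) (f : X → Y) (α : ⟦ T ⟧ X) (β : ⟦ T ⟧ Y) →
  Eq T (fmap T f α) β →
  Σ (Star X α ⤖ Star Y β) (λ g →
      Eq T (fmap T (Bijection.to g) (star X α)) (star Y β)
    × ((x : Star X α) → f (h X α x) ≡ h Y β (Bijection.to g x)))
  where open UniformConstruction U

module Submission where

-- Every element α ∈ T X decomposes into a *shape* and a family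
-- of values indexed by its set of *positions* Pos T α (the occurrences of Id
-- in α).  The uniform construction takes X_* = Pos T α, α_* = α with every
-- value replaced by its own position, and h_α = the map reading the value at
-- a position; then T h_α (α_*) = α.
--
-- For strong adequacy, T f (α) = β forces α and β to have the same shape,
-- and positions of equally shaped elements correspond canonically.  This
-- correspondence g : Pos T α → Pos T β is a bijection (transporting back and
-- forth along any two shape witnesses is the identity), it carries α_* to
-- β_*, and it satisfies f ∘ h_α = h_β ∘ g.

open import Defs
open import Data.Product using (Σ; _,_)
open import Data.Sum using (_⊎_; inj₁; inj₂)
open import Data.Unit using (⊤; tt)
open import Data.Empty using (⊥)
open import Relation.Binary.PropositionalEquality using (_≡_; refl; cong)
open import Function.Bundles using (_⤖_; mk↔ₛ′)
open import Function.Properties.Inverse using (↔⇒⤖)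

Pos : (T : EPF) {X : Set} → ⟦ T ⟧ X → Set
Pos (K C)   c       = ⊥
Pos Id      x       = ⊤
Pos (S ⊗ T) (a , b) = Pos S a ⊎ Pos T b
Pos (∐ I T) (i , a) = Pos (T i) a
Pos (T ^ C) g       = Σ C (λ c → Pos T (g c))

look : (T : EPF) {X : Set} (α : ⟦ T ⟧ X) → Pos T α → X
look Id      x       tt       = x
look (S ⊗ T) (a , b) (inj₁ p) = look S a p
look (S ⊗ T) (a , b) (inj₂ p) = look T b p
look (∐ I T) (i , a) p        = look (T i) a p
look (T ^ C) g       (c , p)  = look T (g c) p

fill : (T : EPF) {X Z : Set} (α : ⟦ T ⟧ X) → (Pos T α → Z) → ⟦ T ⟧ Z
fill (K C)   c       k = c
fill Id      x       k = k tt
fill (S ⊗ T) (a , b) k = fill S a (λ p → k (inj₁ p)) , fill T b (λ p → k (inj₂ p))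
fill (∐ I T) (i , a) k = i , fill (T i) a k
fill (T ^ C) g       k = λ c → fill T (g c) (λ p → k (c , p))

fill-reconstructs : (T : EPF) {X Z : Set} (α : ⟦ T ⟧ X) (k : Pos T α → Z) (f : Z → X) →
                    (∀ p → f (k p) ≡ look T α p) → Eq T (fmap T f (fill T α k)) α
fill-reconstructs (K C)   c       k f e = refl
fill-reconstructs Id      x       k f e = e tt
fill-reconstructs (S ⊗ T) (a , b) k f e =
  fill-reconstructs S a _ f (λ p → e (inj₁ p)) , fill-reconstructs T b _ f (λ p → e (inj₂ p))
fill-reconstructs (∐ I T) (i , a) k f e = refl , fill-reconstructs (T i) a k f e
fill-reconstructs (T ^ C) g       k f e = λ c → fill-reconstructs T (g c) _ f (λ p → e (c , p))

positionConstruction : (T : EPF) → UniformConstruction T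
positionConstruction T = record
  { Star = λ X α → Pos T α
  ; star = λ X α → fill T α (λ p → p)
  ; h    = λ X α → look T α
  ; law  = λ X α → fill-reconstructs T α (λ p → p) (look T α) (λ p → refl)
  }

data Shape {X Y : Set} : (T : EPF) → ⟦ T ⟧ X → ⟦ T ⟧ Y → Set₁ where
  const : ∀ {C} (c : C) → Shape (K C) c c
  value : ∀ x y → Shape Id x y
  pair  : ∀ {S T a a′ b b′} → Shape S a a′ → Shape T b b′ → Shape (S ⊗ T) (a , b) (a′ , b′)
  inj   : ∀ {I T} (i : I) {a b} → Shape (T i) a b → Shape (∐ I T) (i , a) (i , b)
  exp   : ∀ {T C g g′} → (∀ (c : C) → Shape T (g c) (g′ c)) → Shape (T ^ C) g g′

shapeOf : (T : EPF) {X Y : Set} (f : X → Y) (α : ⟦ T ⟧ X) (β : ⟦ T ⟧ Y) →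
          Eq T (fmap T f α) β → Shape T α β
shapeOf (K C)   f c       .c        refl       = const c
shapeOf Id      f x       y         e          = value x y
shapeOf (S ⊗ T) f (a , b) (a′ , b′) (e₁ , e₂)  = pair (shapeOf S f a a′ e₁) (shapeOf T f b b′ e₂)
shapeOf (∐ I T) f (i , a) (.i , b)  (refl , e) = inj i (shapeOf (T i) f a b e)
shapeOf (T ^ C) f g       g′        e          = exp (λ c → shapeOf T f (g c) (g′ c) (e c))

shape-sym : {T : EPF} {X Y : Set} {α : ⟦ T ⟧ X} {β : ⟦ T ⟧ Y} → Shape T α β → Shape T β α
shape-sym (const c)   = const c
shape-sym (value x y) = value y x
shape-sym (pair s t)  = pair (shape-sym s) (shape-sym t)
shape-sym (inj i s)   = inj i (shape-sym s)
shape-sym (exp s)     = exp (λ c → shape-sym (s c))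

transport : {T : EPF} {X Y : Set} {α : ⟦ T ⟧ X} {β : ⟦ T ⟧ Y} → Shape T α β → Pos T α → Pos T β
transport (value x y) tt       = tt
transport (pair s t)  (inj₁ p) = inj₁ (transport s p)
transport (pair s t)  (inj₂ p) = inj₂ (transport t p)
transport (inj i s)   p        = transport s p
transport (exp s)     (c , p)  = c , transport (s c) p

transport-cancel : {T : EPF} {X Y : Set} {α : ⟦ T ⟧ X} {β : ⟦ T ⟧ Y}
                   (s : Shape T α β) (s′ : Shape T β α) → ∀ p → transport s′ (transport s p) ≡ p
transport-cancel (value x y) (value y x)  tt       = refl
transport-cancel (pair s t)  (pair s′ t′) (inj₁ p) = cong inj₁ (transport-cancel s s′ p)
transport-cancel (pair s t)  (pair s′ t′) (inj₂ p) = cong inj₂ (transport-cancel t t′ p)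
transport-cancel (inj i s)   (inj i s′)   p        = transport-cancel s s′ p
transport-cancel (exp s)     (exp s′)     (c , p)  = cong (c ,_) (transport-cancel (s c) (s′ c) p)

transport-bijection : {T : EPF} {X Y : Set} {α : ⟦ T ⟧ X} {β : ⟦ T ⟧ Y} →
                      Shape T α β → Pos T α ⤖ Pos T β
transport-bijection s = ↔⇒⤖ (mk↔ₛ′ (transport s) (transport (shape-sym s))
  (transport-cancel (shape-sym s) s) (transport-cancel s (shape-sym s)))

fill-transport : {T : EPF} {X Y : Set} {α : ⟦ T ⟧ X} {β : ⟦ T ⟧ Y} (s : Shape T α β)
                 {Z W : Set} (k : Pos T α → Z) (k′ : Pos T β → W) (g : Z → W) →
                 (∀ p → g (k p) ≡ k′ (transport s p)) →
                 Eq T (fmap T g (fill T α k)) (fill T β k′)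
fill-transport (const c)   k k′ g e = refl
fill-transport (value x y) k k′ g e = e tt
fill-transport (pair s t)  k k′ g e =
  fill-transport s _ _ g (λ p → e (inj₁ p)) , fill-transport t _ _ g (λ p → e (inj₂ p))
fill-transport (inj i s)   k k′ g e = refl , fill-transport s k k′ g e
fill-transport (exp s)     k k′ g e = λ c → fill-transport (s c) _ _ g (λ p → e (c , p))

look-transport : (T : EPF) {X Y : Set} (f : X → Y) (α : ⟦ T ⟧ X) (β : ⟦ T ⟧ Y)
                 (e : Eq T (fmap T f α) β) →
                 ∀ p → f (look T α p) ≡ look T β (transport (shapeOf T f α β e) p)
look-transport Id      f x       y         e          tt       = e
look-transport (S ⊗ T) f (a , b) (a′ , b′) (e₁ , e₂)  (inj₁ p) = look-transport S f a a′ e₁ p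
look-transport (S ⊗ T) f (a , b) (a′ , b′) (e₁ , e₂)  (inj₂ p) = look-transport T f b b′ e₂ p
look-transport (∐ I T) f (i , a) (.i , b)  (refl , e) p        = look-transport (T i) f a b e p
look-transport (T ^ C) f g       g′        e          (c , p)  = look-transport T f (g c) (g′ c) (e c) p

positionConstruction-adequate : (T : EPF) → StronglyAdequate T (positionConstruction T)
positionConstruction-adequate T X Y f α β e =
  transport-bijection s ,
  fill-transport s (λ p → p) (λ p → p) (transport s) (λ p → refl) ,
  look-transport T f α β e
  where
  s : Shape T α β
  s = shapeOf T f α β e

mainTheorem12 : (T : EPF) → Σ (UniformConstruction T) (StronglyAdequate T)
mainTheorem12 T = positionConstruction T , positionConstruction-adequate T
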